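{- If $1\le k\le n-2$, then $rc^*(C_n([k])) = src^*(C_n([k])) = \lceil n/k\rceil$, where $[k]=\{1,2,\dots,k\}$.
   Context: For an integer $n\ge 2$ and $S\subseteq\{1,\dots,n-1\}$, the circulant digraph $C_n(S)$ has vertex set $\{v_0,\dots,v_{n-1}\}$ and arcs $v_iv_j$ whenever $j-i\equiv s \pmod n$ for some $s\in S$. For an arc-colouring of a strongly connected digraph $D$, a directed path is rainbow if no two of its arcs have the same colour. $rc^*(D)$ is the minimum number of colours in an arc-colouring such that for every ordered pair of distinct vertices $x,y$ there is a rainbow directed $xy$-path. $src^*(D)$ is the minimum number of colours in an arc-colouring such that for every ordered pair of distinct vertices $x,y$ there is a rainbow directed $xy$-path of length equal to the directed distance $d_D(x,y)$. -}

module Defs where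

open import Data.Nat using (ℕ; zero; suc; _+_; _∸_; _≤_; _<_; NonZero)
open import Data.Nat.DivMod using (_%_; _/_)
open import Data.Fin using (Fin; toℕ)
open import Data.List using (List; []; _∷_; length)
open import Data.List.Relation.Unary.Unique.Propositional using (Unique)
open import Data.Product using (Σ; _×_; _,_; ∃)
open import Relation.Binary.PropositionalEquality using (_≡_; _≢_)

Digraph : ℕ → Set₁
Digraph n = Fin n → Fin n → Set

-- Circulant digraph C_n([k]) : arc v_i v_j iff (j - i) mod n ∈ {1,…,k}.
-- (j - i) mod n is computed as (j + n - i) % n.
circulant : (n k : ℕ) → .{{_ : NonZero n}} → Digraph n
circulant n k i j =
  let s = (toℕ j + n ∸ toℕ i) % n in (1 ≤ s) × (s ≤ k)

-- An xy-walk in D, given as its vertex sequence x = u₀, …, u_m = y.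
-- WalkFrom D x vs y : the list vs are the vertices after x, ending at y.
data Walk {n : ℕ} (D : Digraph n) : Fin n → List (Fin n) → Fin n → Set where
  stop : ∀ {x} → Walk D x [] x
  step : ∀ {x z vs y} → D x z → Walk D z vs y → Walk D x (z ∷ vs) y

record Path {n : ℕ} (D : Digraph n) (x y : Fin n) : Set where
  constructor mkPath
  field
    verts  : List (Fin n)
    walk   : Walk D x verts y
    simple : Unique (x ∷ verts)

open Path public

len : ∀ {n} {D : Digraph n} {x y} → Path D x y → ℕ
len p = length (verts p)


-- Colour sequence of the arcs of a path under an arc-colouring col.
-- (An arc-colouring is a map on ordered pairs; only its values on arcs matter.)
coloursOf : ∀ {n c} → (Fin n → Fin n → Fin c) → Fin n → List (Fin n) → List (Fin c)
coloursOf col x [] = []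
coloursOf col x (z ∷ vs) = col x z ∷ coloursOf col z vs

Rainbow : ∀ {n c} {D : Digraph n} {x y} → (Fin n → Fin n → Fin c) → Path D x y → Set
Rainbow {x = x} col p = Unique (coloursOf col x (verts p))

IsDistance : ∀ {n} → Digraph n → Fin n → Fin n → ℕ → Set
IsDistance D x y d = (Σ (Path D x y) λ p → len p ≡ d) × (∀ (p : Path D x y) → d ≤ len p)

StronglyConnected : ∀ {n} → Digraph n → Set
StronglyConnected D = ∀ x y → Path D x y

RainbowConnecting : ∀ {n} (D : Digraph n) (c : ℕ) → Set
RainbowConnecting {n} D c =
  Σ (Fin n → Fin n → Fin c) λ col →
    ∀ x y → x ≢ y → Σ (Path D x y) λ p → Rainbow col p

StrongRainbowConnecting : ∀ {n} (D : Digraph n) (c : ℕ) → Set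
StrongRainbowConnecting {n} D c =
  Σ (Fin n → Fin n → Fin c) λ col →
    ∀ x y → x ≢ y → Σ (Path D x y) λ p → Rainbow col p × IsDistance D x y (len p)

IsMinimum : (ℕ → Set) → ℕ → Set
IsMinimum P m = P m × (∀ c → P c → m ≤ c)

rc*≡ : ∀ {n} → Digraph n → ℕ → Set
rc*≡ D m = IsMinimum (RainbowConnecting D) m

src*≡ : ∀ {n} → Digraph n → ℕ → Set
src*≡ D m = IsMinimum (StrongRainbowConnecting D) m

ceilDiv : (a b : ℕ) → .{{_ : NonZero b}} → ℕ
ceilDiv a b = (a + b ∸ 1) / b

module Submission where

-- Lower bound: a rainbow path with c colours has at most c arcs, each of offset at most k, so
-- reaching v_{n-1} from v_0 needs c k ≥ n - 1. If c k = n - 1, the rainbow path from v_i to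
-- v_{i+ck} must be v_i, v_{i+k}, …, v_{i+ck}; so along the orbit of +k any c consecutive arcs
-- v_j v_{j+k} have distinct colours, which makes these colours c-periodic as well as n-periodic,
-- hence constant — impossible when c ≥ 2.
-- Upper bound: colour each arc by the block ⌊j / k⌋ of its head v_j. Lift the cycle to ℕ; from x
-- to y take ⌈d(x, y) / k⌉ steps, all but one or two of size k, placed so that the heads fall in
-- distinct blocks (going around past v_{n-1} when y < x).

open import Data.Fin using (Fin; zero; suc; toℕ; fromℕ<)
open import Data.Fin.Properties using (toℕ<n; toℕ-fromℕ<; toℕ-injective; injective⇒≤) renaming (_≟_ to _≟ᶠ_)
open import Data.List using (List; []; _∷_; _++_; _∷ʳ_; [_]; length; map; lookup; iterate)
open import Data.List.Properties using (length-map; length-iterate; length-++; map-++)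
open import Data.List.Membership.Propositional using (_∈_)
open import Data.List.Membership.Propositional.Properties using (∈-lookup; ∈-++⁻)
import Data.List.Membership.DecPropositional as DecMembership
open import Data.List.Relation.Unary.All as All using (All; []; _∷_)
open import Data.List.Relation.Unary.All.Properties using (¬Any⇒All¬) renaming (map⁺ to All-map⁺)
open import Data.List.Relation.Unary.Any using (here)
open import Data.List.Relation.Unary.Unique.Propositional using (Unique; []; _∷_)
import Data.List.Relation.Unary.Unique.Propositional.Properties as Unique
open import Data.Nat
open import Data.Nat.DivMod
open import Data.Nat.Divisibility using (_∣_; ∣-refl; _∣0)
import Data.Nat.GeneralisedArithmetic as ℕ
open import Data.Nat.Properties
open import Data.Nat.Tactic.RingSolver using (solve-∀)
open import Data.Product using (Σ; _×_; _,_; proj₁; proj₂)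
open import Data.Sum using (inj₁; inj₂)
open import Function.Base using (_∘_)
open import Function.Definitions using (Injective)
open import Relation.Binary using (tri<; tri≈; tri>)
open import Relation.Binary.PropositionalEquality
  using (_≡_; _≢_; ≢-sym; refl; sym; trans; cong; cong₂; subst; subst₂; module ≡-Reasoning)
open import Relation.Nullary using (yes; no; contradiction)

open import Defs

private
  variable
    A : Set
    c : ℕ

lookup-injective : {xs : List A} → Unique xs → Injective _≡_ _≡_ (lookup xs)
lookup-injective (_   ∷ _) {zero}  {zero}  _  = refl
lookup-injective (x∉ ∷ _) {zero}  {suc j} eq = contradiction eq (All.lookup x∉ (∈-lookup j))
lookup-injective (x∉ ∷ _) {suc i} {zero}  eq = contradiction (sym eq) (All.lookup x∉ (∈-lookup i))
lookup-injective (_   ∷ u) {suc i} {suc j} eq = cong suc (lookup-injective u eq)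

unique⇒length≤ : {xs : List (Fin c)} → Unique xs → length xs ≤ c
unique⇒length≤ u = injective⇒≤ (lookup-injective u)

unique⇒∈ : {xs : List (Fin c)} → Unique xs → c ≤ length xs → ∀ z → z ∈ xs
unique⇒∈ {xs = xs} u c≤ z with DecMembership._∈?_ _≟ᶠ_ z xs
... | yes z∈xs = z∈xs
... | no  z∉xs = contradiction (≤-trans (unique⇒length≤ (¬Any⇒All¬ xs z∉xs ∷ u)) c≤) (n≮n _)

iterate-∷ʳ : ∀ (f : A → A) x m → iterate f x (suc m) ≡ iterate f x m ∷ʳ ℕ.iterate f x m
iterate-∷ʳ f x zero    = refl
iterate-∷ʳ f x (suc m) = cong (x ∷_) (iterate-∷ʳ f (f x) m)

iterate-+ : ∀ (f : A → A) x m o → ℕ.iterate f x (m + o) ≡ ℕ.iterate f (ℕ.iterate f x m) o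
iterate-+ f x zero    o = refl
iterate-+ f x (suc m) o = iterate-+ f (f x) m o

-- The window at f x has c distinct colours out of c, so it contains g x; but g x is not among
-- its first c - 1 entries, which also lie in the window at x.
rainbow-windows⇒periodic : ∀ (f : A → A) (g : A → Fin c) →
  (∀ x → Unique (map g (iterate f x c))) → ∀ x → g (ℕ.iterate f x c) ≡ g x
rainbow-windows⇒periodic {c = zero}   f g windows x = refl
rainbow-windows⇒periodic {c = suc c′} f g windows x
  with ∈-++⁻ (map g (iterate f (f x) c′)) gx∈window
  where
  window≡ : map g (iterate f (f x) (suc c′)) ≡ map g (iterate f (f x) c′) ++ [ g (ℕ.iterate f x (suc c′)) ]
  window≡ = trans (cong (map g) (iterate-∷ʳ f (f x) c′)) (map-++ g (iterate f (f x) c′) _)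
  full : suc c′ ≤ length (map g (iterate f (f x) (suc c′)))
  full = ≤-reflexive (sym (trans (length-map g (iterate f (f x) (suc c′))) (length-iterate f (f x) (suc c′))))
  gx∈window = subst (g x ∈_) window≡ (unique⇒∈ (windows (f x)) full (g x))
... | inj₁ gx∈tail     = contradiction gx∈tail (Unique.Unique[x∷xs]⇒x∉xs (windows x))
... | inj₂ (here gx≡) = sym gx≡

rainbow-window⇒≢ : ∀ (f : A → A) (g : A → Fin c) {x m} → 2 ≤ m →
  Unique (map g (iterate f x m)) → g x ≢ g (f x)
rainbow-window⇒≢ f g (s≤s (s≤s _)) ((gx∉ ∷ _) ∷ _) = gx∉

module _ (n : ℕ) .{{_ : NonZero n}} where

  [m%n+o]%n≡[m+o]%n : ∀ m o → (m % n + o) % n ≡ (m + o) % n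
  [m%n+o]%n≡[m+o]%n m o = begin
    (m % n + o) % n         ≡⟨ %-distribˡ-+ (m % n) o n ⟩
    (m % n % n + o % n) % n ≡⟨ cong (λ v → (v + o % n) % n) (m%n%n≡m%n m n) ⟩
    (m % n + o % n) % n     ≡⟨ %-distribˡ-+ m o n ⟨
    (m + o) % n             ∎
    where open ≡-Reasoning

  [m+o%n]%n≡[m+o]%n : ∀ m o → (m + o % n) % n ≡ (m + o) % n
  [m+o%n]%n≡[m+o]%n m o = begin
    (m + o % n) % n ≡⟨ cong (_% n) (+-comm m (o % n)) ⟩
    (o % n + m) % n ≡⟨ [m%n+o]%n≡[m+o]%n o m ⟩
    (o + m) % n     ≡⟨ cong (_% n) (+-comm o m) ⟩
    (m + o) % n     ∎
    where open ≡-Reasoning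

  -- Adding r = n ∸ m % n undoes the translation by m.
  [m+o]%n≡[m+p]%n⇒o≡p : ∀ m {o p} → o < n → p < n → (m + o) % n ≡ (m + p) % n → o ≡ p
  [m+o]%n≡[m+p]%n⇒o≡p m {o} {p} o<n p<n eq = begin
    o                      ≡⟨ untranslate o<n ⟨
    (r + (m + o)) % n      ≡⟨ [m+o%n]%n≡[m+o]%n r (m + o) ⟨
    (r + (m + o) % n) % n  ≡⟨ cong (λ v → (r + v) % n) eq ⟩
    (r + (m + p) % n) % n  ≡⟨ [m+o%n]%n≡[m+o]%n r (m + p) ⟩
    (r + (m + p)) % n      ≡⟨ untranslate p<n ⟩
    p                      ∎
    where
    open ≡-Reasoning
    r = n ∸ m % n
    [r+m]%n≡0 : (r + m) % n ≡ 0
    [r+m]%n≡0 = begin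
      (r + m) % n                     ≡⟨ cong (λ v → (r + v) % n) (m≡m%n+[m/n]*n m n) ⟩
      (r + (m % n + m / n * n)) % n   ≡⟨ cong (_% n) (+-assoc r (m % n) _) ⟨
      (r + m % n + m / n * n) % n     ≡⟨ cong (λ v → (v + m / n * n) % n) (m∸n+n≡m (m%n≤n m n)) ⟩
      (n + m / n * n) % n             ≡⟨ [m+kn]%n≡m%n n (m / n) n ⟩
      n % n                           ≡⟨ n%n≡0 n ⟩
      0                               ∎
    untranslate : ∀ {o} → o < n → (r + (m + o)) % n ≡ o
    untranslate {o} o<n = begin
      (r + (m + o)) % n     ≡⟨ cong (_% n) (+-assoc r m o) ⟨
      (r + m + o) % n       ≡⟨ [m%n+o]%n≡[m+o]%n (r + m) o ⟨
      ((r + m) % n + o) % n ≡⟨ cong (λ v → (v + o) % n) [r+m]%n≡0 ⟩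
      o % n                 ≡⟨ m<n⇒m%n≡m o<n ⟩
      o                     ∎

module _ (a b : ℕ) .{{_ : NonZero b}} where

  private
    N = a + b ∸ 1

    suc[N]≡a+b : suc N ≡ a + b
    suc[N]≡a+b = m+[n∸m]≡n (≤-trans (>-nonZero⁻¹ b) (m≤n+m b a))

  ceilDiv-lower : a ≤ ceilDiv a b * b
  ceilDiv-lower = +-cancelʳ-≤ b a (ceilDiv a b * b) (begin
    a + b                         ≡⟨ suc[N]≡a+b ⟨
    suc N                         ≡⟨ cong suc (m≡m%n+[m/n]*n N b) ⟩
    suc (N % b) + ceilDiv a b * b ≤⟨ +-monoˡ-≤ _ (m%n<n N b) ⟩
    b + ceilDiv a b * b           ≡⟨ +-comm b _ ⟩
    ceilDiv a b * b + b           ∎)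
    where open ≤-Reasoning

  ceilDiv-least : ∀ c → a ≤ c * b → ceilDiv a b ≤ c
  ceilDiv-least c a≤cb = s≤s⁻¹ (*-cancelʳ-< b (ceilDiv a b) (suc c) (begin-strict
    ceilDiv a b * b ≤⟨ m/n*n≤m N b ⟩
    N               <⟨ n<1+n N ⟩
    suc N           ≡⟨ suc[N]≡a+b ⟩
    a + b           ≤⟨ +-monoˡ-≤ b a≤cb ⟩
    c * b + b       ≡⟨ +-comm (c * b) b ⟩
    suc c * b       ∎))
    where open ≤-Reasoning

≤-+-≡⇒≡ : ∀ {m n o p} → m ≤ n → o ≤ p → m + o ≡ n + p → m ≡ n × o ≡ p
≤-+-≡⇒≡ {m} {n} {o} {p} m≤n o≤p eq = m≡n , +-cancelˡ-≡ n o p (subst (λ v → v + o ≡ n + p) m≡n eq)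
  where
  m≡n : m ≡ n
  m≡n = ≤-antisym m≤n (+-cancelʳ-≤ p n m (subst (_≤ m + p) eq (+-monoʳ-≤ m o≤p)))

[m+n]/n≡1+m/n : ∀ m n .{{_ : NonZero n}} → (m + n) / n ≡ suc (m / n)
[m+n]/n≡1+m/n m n = begin
  (m + n) / n     ≡⟨ +-distrib-/-∣ʳ m ∣-refl ⟩
  m / n + n / n   ≡⟨ cong (m / n +_) (n/n≡1 n) ⟩
  m / n + 1       ≡⟨ +-comm (m / n) 1 ⟩
  suc (m / n)     ∎
  where open ≡-Reasoning

iterate-suc-bounds : ∀ a m → All (λ v → a ≤ v × v < a + m) (iterate suc a m)
iterate-suc-bounds a zero    = []
iterate-suc-bounds a (suc m) = (≤-refl , m<m+n a z<s) ∷
  All.map (λ {v} (a<v , v<) → <⇒≤ a<v , subst (v <_) (sym (+-suc a m)) v<) (iterate-suc-bounds (suc a) m)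

iterate-suc-unique : ∀ a m → Unique (iterate suc a m)
iterate-suc-unique a zero    = []
iterate-suc-unique a (suc m) =
  All.map (λ (a<v , _) → <⇒≢ a<v) (iterate-suc-bounds (suc a) m) ∷ iterate-suc-unique (suc a) m

iterate-suc-++-unique : ∀ a m b m′ → b + m′ ≤ a → Unique (iterate suc a m ++ iterate suc b m′)
iterate-suc-++-unique a m b m′ b+m′≤a = Unique.++⁺ (iterate-suc-unique a m) (iterate-suc-unique b m′)
  λ (v∈ , v∈′) → <⇒≱ (<-≤-trans (proj₂ (All.lookup (iterate-suc-bounds b m′) v∈′)) b+m′≤a)
                      (proj₁ (All.lookup (iterate-suc-bounds a m) v∈))

-- The heads of a walk in a circulant with offsets at most k, lifted from ℤ/n to ℕ.
data Ascent (k : ℕ) : ℕ → List ℕ → ℕ → Set where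
  []  : ∀ {a} → Ascent k a [] a
  hop : ∀ {a b us e} → a < b → b ≤ a + k → Ascent k b us e → Ascent k a (b ∷ us) e

module _ {k : ℕ} where

  ascent-≤ : ∀ {a us e} → Ascent k a us e → a ≤ e
  ascent-≤ []              = ≤-refl
  ascent-≤ (hop a<b _ asc) = ≤-trans (<⇒≤ a<b) (ascent-≤ asc)

  ascent-bounds : ∀ {a us e} → Ascent k a us e → All (λ b → a < b × b ≤ e) us
  ascent-bounds []                = []
  ascent-bounds (hop a<b _ asc) =
    (a<b , ascent-≤ asc) ∷ All.map (λ (b<c , c≤e) → <-trans a<b b<c , c≤e) (ascent-bounds asc)

  ascent-++ : ∀ {a us m vs e} → Ascent k a us m → Ascent k m vs e → Ascent k a (us ++ vs) e
  ascent-++ []              asc′ = asc′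
  ascent-++ (hop a<b b≤ asc) asc′ = hop a<b b≤ (ascent-++ asc asc′)

  progression : .{{_ : NonZero k}} → ∀ a m → Ascent k a (iterate (_+ k) (a + k) m) (a + m * k)
  progression a zero    = subst (Ascent k a []) (sym (+-identityʳ a)) []
  progression a (suc m) = hop (m<m+n a (>-nonZero⁻¹ k)) ≤-refl
    (subst (Ascent k (a + k) _) (+-assoc a k (m * k)) (progression (a + k) m))

module _ {n : ℕ} {c : ℕ} (col : Fin n → Fin n → Fin c) where

  length-coloursOf : ∀ x vs → length (coloursOf col x vs) ≡ length vs
  length-coloursOf x []       = refl
  length-coloursOf x (z ∷ vs) = cong suc (length-coloursOf z vs)

  coloursOf-iterate : ∀ (f : Fin n → Fin n) x m →
    coloursOf col x (iterate f (f x) m) ≡ map (λ v → col v (f v)) (iterate f x m)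
  coloursOf-iterate f x zero    = refl
  coloursOf-iterate f x (suc m) = cong (col x (f x) ∷_) (coloursOf-iterate f (f x) m)

  rainbow⇒len≤ : ∀ {D : Digraph n} {x y} (p : Path D x y) → Rainbow col p → len p ≤ c
  rainbow⇒len≤ {x = x} p rainbow =
    subst (_≤ c) (length-coloursOf x (verts p)) (unique⇒length≤ rainbow)

strong⇒rainbow : ∀ {n c} {D : Digraph n} → StrongRainbowConnecting D c → RainbowConnecting D c
strong⇒rainbow (col , paths) = col , λ x y x≢y → let (p , rainbow , _) = paths x y x≢y in p , rainbow

module Circulant (n k : ℕ) .{{_ : NonZero n}} .{{_ : NonZero k}} where

  D : Digraph n
  D = circulant n k

  -- The arc condition of circulant n k is 1 ≤ offset x y ≤ k, definitionally.
  offset : Fin n → Fin n → ℕ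
  offset x y = (toℕ y + n ∸ toℕ x) % n

  toℕ-mod : ∀ x → toℕ x mod n ≡ x
  toℕ-mod x = toℕ-injective (trans (toℕ-fromℕ< _) (m<n⇒m%n≡m (toℕ<n x)))

  mod-toℕ : ∀ {m} {y : Fin n} → m % n ≡ toℕ y → m mod n ≡ y
  mod-toℕ m%n≡y = toℕ-injective (trans (toℕ-fromℕ< _) m%n≡y)

  +-offset : ∀ x y → (toℕ x + offset x y) % n ≡ toℕ y
  +-offset x y = begin
    (toℕ x + (toℕ y + n ∸ toℕ x) % n) % n ≡⟨ [m+o%n]%n≡[m+o]%n n (toℕ x) _ ⟩
    (toℕ x + (toℕ y + n ∸ toℕ x)) % n     ≡⟨ cong (_% n) (m+[n∸m]≡n x≤y+n) ⟩
    (toℕ y + n) % n                       ≡⟨ [m+n]%n≡m%n (toℕ y) n ⟩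
    toℕ y % n                             ≡⟨ m<n⇒m%n≡m (toℕ<n y) ⟩
    toℕ y                                 ∎
    where
    open ≡-Reasoning
    x≤y+n = ≤-trans (<⇒≤ (toℕ<n x)) (m≤n+m n (toℕ y))

  offset-unique : ∀ {x y s} → s < n → (toℕ x + s) % n ≡ toℕ y → offset x y ≡ s
  offset-unique {x} {y} s<n eq =
    [m+o]%n≡[m+p]%n⇒o≡p n (toℕ x) (m%n<n _ n) s<n (trans (+-offset x y) (sym eq))

  offset-mod : ∀ m {s} → s < n → offset (m mod n) ((m + s) mod n) ≡ s
  offset-mod m {s} s<n = offset-unique s<n (begin
    (toℕ (m mod n) + s) % n ≡⟨ cong (λ v → (v + s) % n) (toℕ-fromℕ< _) ⟩
    (m % n + s) % n         ≡⟨ [m%n+o]%n≡[m+o]%n n m s ⟩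
    (m + s) % n             ≡⟨ toℕ-fromℕ< _ ⟨
    toℕ ((m + s) mod n)     ∎)
    where open ≡-Reasoning

  offset-self : ∀ x → offset x x ≡ 0
  offset-self x = offset-unique (>-nonZero⁻¹ n)
    (trans (cong (_% n) (+-identityʳ (toℕ x))) (m<n⇒m%n≡m (toℕ<n x)))

  offset≢0⇒≢ : ∀ {x y} → offset x y ≢ 0 → x ≢ y
  offset≢0⇒≢ {x} offset≢0 refl = offset≢0 (offset-self x)

  walkSum : ∀ {x vs y} → Walk D x vs y → ℕ
  walkSum stop               = 0
  walkSum (step {x} {z} _ w) = offset x z + walkSum w

  walkSum≤ : ∀ {x vs y} (w : Walk D x vs y) → walkSum w ≤ length vs * k
  walkSum≤ stop                = z≤n
  walkSum≤ (step (_ , o≤k) w) = +-mono-≤ o≤k (walkSum≤ w)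

  +-walkSum : ∀ {x vs y} (w : Walk D x vs y) → (toℕ x + walkSum w) % n ≡ toℕ y
  +-walkSum {x} stop = trans (cong (_% n) (+-identityʳ (toℕ x))) (m<n⇒m%n≡m (toℕ<n x))
  +-walkSum {x} (step {z = z} _ w) = begin
    (toℕ x + (offset x z + walkSum w)) % n      ≡⟨ cong (_% n) (+-assoc (toℕ x) _ _) ⟨
    (toℕ x + offset x z + walkSum w) % n        ≡⟨ [m%n+o]%n≡[m+o]%n n _ (walkSum w) ⟨
    ((toℕ x + offset x z) % n + walkSum w) % n  ≡⟨ cong (λ v → (v + walkSum w) % n) (+-offset x z) ⟩
    (toℕ z + walkSum w) % n                     ≡⟨ +-walkSum w ⟩
    _                                           ∎
    where open ≡-Reasoning

  offset≤walkSum : ∀ {x vs y} (w : Walk D x vs y) → offset x y ≤ walkSum w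
  offset≤walkSum {x} w = subst (_≤ walkSum w) (sym offset≡) (m%n≤m (walkSum w) n)
    where
    offset≡ = offset-unique (m%n<n (walkSum w) n)
      (trans ([m+o%n]%n≡[m+o]%n n (toℕ x) (walkSum w)) (+-walkSum w))

  -- The hypothesis says len p ≤ ⌈offset x y / k⌉, a lower bound for the length of every xy-walk.
  len*k<offset+k⇒IsDistance : ∀ {x y} (p : Path D x y) → len p * k < offset x y + k → IsDistance D x y (len p)
  len*k<offset+k⇒IsDistance {x} {y} p short = (p , refl) , λ q → s≤s⁻¹ (*-cancelʳ-< k (len p) (suc (len q)) (begin-strict
    len p * k      <⟨ short ⟩
    offset x y + k ≤⟨ +-monoˡ-≤ k (≤-trans (offset≤walkSum (walk q)) (walkSum≤ (walk q))) ⟩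
    len q * k + k  ≡⟨ +-comm (len q * k) k ⟩
    suc (len q) * k ∎))
    where open ≤-Reasoning

  next : Fin n → Fin n
  next x = (toℕ x + k) mod n

  toℕ-iterate-next : ∀ m x → toℕ (ℕ.iterate next x m) ≡ (toℕ x + m * k) % n
  toℕ-iterate-next zero    x = sym (trans (cong (_% n) (+-identityʳ (toℕ x))) (m<n⇒m%n≡m (toℕ<n x)))
  toℕ-iterate-next (suc m) x = begin
    toℕ (ℕ.iterate next (next x) m)    ≡⟨ toℕ-iterate-next m (next x) ⟩
    (toℕ (next x) + m * k) % n         ≡⟨ cong (λ v → (v + m * k) % n) (toℕ-fromℕ< _) ⟩
    ((toℕ x + k) % n + m * k) % n      ≡⟨ [m%n+o]%n≡[m+o]%n n (toℕ x + k) (m * k) ⟩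
    (toℕ x + k + m * k) % n            ≡⟨ cong (_% n) (+-assoc (toℕ x) k (m * k)) ⟩
    (toℕ x + suc m * k) % n            ∎
    where open ≡-Reasoning

  iterate-next-n : ∀ x → ℕ.iterate next x n ≡ x
  iterate-next-n x = toℕ-injective (begin
    toℕ (ℕ.iterate next x n) ≡⟨ toℕ-iterate-next n x ⟩
    (toℕ x + n * k) % n      ≡⟨ cong (λ v → (toℕ x + v) % n) (*-comm n k) ⟩
    (toℕ x + k * n) % n      ≡⟨ [m+kn]%n≡m%n (toℕ x) k n ⟩
    toℕ x % n                ≡⟨ m<n⇒m%n≡m (toℕ<n x) ⟩
    toℕ x                    ∎)
    where open ≡-Reasoning

  walkSum≡length*k⇒iterate-next : ∀ {x vs y} (w : Walk D x vs y) → walkSum w ≡ length vs * k →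
    vs ≡ iterate next (next x) (length vs)
  walkSum≡length*k⇒iterate-next stop _ = refl
  walkSum≡length*k⇒iterate-next {x} (step {z = z} {vs = vs} (_ , o≤k) w) eq =
    cong₂ _∷_ z≡next (trans (walkSum≡length*k⇒iterate-next w T≡) (cong (λ v → iterate next (next v) (length vs)) z≡next))
    where
    o≡k,T≡ = ≤-+-≡⇒≡ o≤k (walkSum≤ w) eq
    T≡ = proj₂ o≡k,T≡
    z≡next : z ≡ next x
    z≡next = toℕ-injective (begin
      toℕ z                          ≡⟨ +-offset x z ⟨
      (toℕ x + offset x z) % n       ≡⟨ cong (λ v → (toℕ x + v) % n) (proj₁ o≡k,T≡) ⟩
      (toℕ x + k) % n                ≡⟨ toℕ-fromℕ< _ ⟨
      toℕ (next x)                   ∎)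
      where open ≡-Reasoning

  module _ {c} (col : Fin n → Fin n → Fin c)
           (rainbow : ∀ x y → x ≢ y → Σ (Path D x y) (Rainbow col)) where

    rainbow⇒n∸1≤c*k : 1 < n → n ∸ 1 ≤ c * k
    rainbow⇒n∸1≤c*k 1<n = begin
      n ∸ 1               ≡⟨ offset≡ ⟨
      offset x₀ y₀        ≤⟨ offset≤walkSum (walk p) ⟩
      walkSum (walk p)    ≤⟨ walkSum≤ (walk p) ⟩
      len p * k           ≤⟨ *-monoˡ-≤ k (rainbow⇒len≤ col p rainbowP) ⟩
      c * k               ∎
      where
      open ≤-Reasoning
      x₀ = 0 mod n
      y₀ = (0 + (n ∸ 1)) mod n
      offset≡ : offset x₀ y₀ ≡ n ∸ 1
      offset≡ = offset-mod 0 (∸-monoʳ-< {n} {1} {0} z<s (<⇒≤ 1<n))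
      x₀≢y₀ : x₀ ≢ y₀
      x₀≢y₀ = offset≢0⇒≢ λ eq → <⇒≢ (m<n⇒0<n∸m 1<n) (sym (trans (sym offset≡) eq))
      p = proj₁ (rainbow x₀ y₀ x₀≢y₀)
      rainbowP = proj₂ (rainbow x₀ y₀ x₀≢y₀)

    g : Fin n → Fin c
    g x = col x (next x)

    rainbow-window : suc (c * k) ≡ n → 0 < c * k → ∀ x → Unique (map g (iterate next x c))
    rainbow-window n≡ c*k>0 x = subst (λ m → Unique (map g (iterate next x m))) L≡c rainbowColours
      where
      y = ℕ.iterate next x c
      offset≡ : offset x y ≡ c * k
      offset≡ = offset-unique (subst (c * k <_) n≡ (n<1+n (c * k))) (sym (toℕ-iterate-next c x))
      x≢y = offset≢0⇒≢ (λ eq → <⇒≢ c*k>0 (sym (trans (sym offset≡) eq)))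
      p = proj₁ (rainbow x y x≢y)
      rainbowP = proj₂ (rainbow x y x≢y)
      L = len p
      L≤c = rainbow⇒len≤ col p rainbowP
      c*k≤T : c * k ≤ walkSum (walk p)
      c*k≤T = subst (_≤ walkSum (walk p)) offset≡ (offset≤walkSum (walk p))
      T≡L*k : walkSum (walk p) ≡ L * k
      T≡L*k = ≤-antisym (walkSum≤ (walk p)) (≤-trans (*-monoˡ-≤ k L≤c) c*k≤T)
      L≡c : L ≡ c
      L≡c = ≤-antisym L≤c (*-cancelʳ-≤ c L k (≤-trans c*k≤T (walkSum≤ (walk p))))
      rainbowColours : Unique (map g (iterate next x L))
      rainbowColours = subst Unique
        (trans (cong (coloursOf col x) (walkSum≡length*k⇒iterate-next (walk p) T≡L*k)) (coloursOf-iterate col next x L))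
        rainbowP

    rainbow⇒suc[c*k]≢n : k + 2 ≤ n → suc (c * k) ≢ n
    rainbow⇒suc[c*k]≢n k+2≤n n≡ = rainbow-window⇒≢ next g 2≤c (window x₀) (sym g[next]≡g)
      where
      x₀ = 0 mod n
      k<c*k : k < c * k
      k<c*k = ≤-pred (subst (_≤ suc (c * k)) (+-comm k 2) (subst (k + 2 ≤_) (sym n≡) k+2≤n))
      2≤c : 2 ≤ c
      2≤c = *-cancelʳ-< k 1 c (subst (_< c * k) (sym (*-identityˡ k)) k<c*k)
      window = rainbow-window n≡ (≤-<-trans z≤n k<c*k)
      periodic : ∀ m x → g (ℕ.iterate next x (m * c)) ≡ g x
      periodic zero    x = refl
      periodic (suc m) x = trans (cong g (iterate-+ next x c (m * c)))
        (trans (periodic m _) (rainbow-windows⇒periodic next g window x))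
      g[next]≡g : g (next x₀) ≡ g x₀
      g[next]≡g = begin
        g (next x₀)                           ≡⟨ periodic k (next x₀) ⟨
        g (ℕ.iterate next x₀ (suc (k * c)))   ≡⟨ cong (λ m → g (ℕ.iterate next x₀ m)) (trans (cong suc (*-comm k c)) n≡) ⟩
        g (ℕ.iterate next x₀ n)               ≡⟨ cong g (iterate-next-n x₀) ⟩
        g x₀                                  ∎
        where open ≡-Reasoning

  rainbow-lower : k + 2 ≤ n → ∀ c → RainbowConnecting D c → ceilDiv n k ≤ c
  rainbow-lower k+2≤n c (col , rainbow) = ceilDiv-least n k c n≤c*k
    where
    1<n = ≤-trans (s≤s (s≤s z≤n)) (≤-trans (m≤n+m 2 k) k+2≤n)
    n≤c*k : n ≤ c * k
    n≤c*k with m≤n⇒m<n∨m≡n (rainbow⇒n∸1≤c*k col rainbow 1<n)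
    ... | inj₁ n∸1<c*k = subst (_≤ c * k) (suc-pred n) n∸1<c*k
    ... | inj₂ n∸1≡c*k = contradiction (trans (cong suc (sym n∸1≡c*k)) (suc-pred n)) (rainbow⇒suc[c*k]≢n col rainbow k+2≤n)

  colour : Fin n → Fin n → Fin (ceilDiv n k)
  colour _ z = fromℕ< (m<n*o⇒m/o<n (<-≤-trans (toℕ<n z) (ceilDiv-lower n k)))

  block : ℕ → ℕ
  block u = (u % n) / k

  colours-lift : ∀ x us → map toℕ (coloursOf colour x (map (_mod n) us)) ≡ map block us
  colours-lift x []       = refl
  colours-lift x (u ∷ us) =
    cong₂ _∷_ (trans (toℕ-fromℕ< _) (cong (_/ k) (toℕ-fromℕ< _))) (colours-lift (u mod n) us)

  block-progression : ∀ o b m → n ∣ o → b + m * k < n + k →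
    map block (iterate (_+ k) (o + b) m) ≡ iterate suc (b / k) m
  block-progression o b zero    _   _     = refl
  block-progression o b (suc m) n∣o bound = cong₂ _∷_ block≡ (begin
    map block (iterate (_+ k) (o + b + k) m)   ≡⟨ cong (λ v → map block (iterate (_+ k) v m)) (+-assoc o b k) ⟩
    map block (iterate (_+ k) (o + (b + k)) m) ≡⟨ block-progression o (b + k) m n∣o bound′ ⟩
    iterate suc ((b + k) / k) m                ≡⟨ cong (λ v → iterate suc v m) ([m+n]/n≡1+m/n b k) ⟩
    iterate suc (suc (b / k)) m                ∎)
    where
    open ≡-Reasoning
    bound′ : b + k + m * k < n + k
    bound′ = subst (_< n + k) (sym (+-assoc b k (m * k))) bound
    b<n : b < n
    b<n = +-cancelʳ-< k b n (≤-<-trans (+-monoʳ-≤ b (m≤m+n k (m * k))) bound)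
    block≡ : block (o + b) ≡ b / k
    block≡ = cong (_/ k) (trans (%-remove-+ˡ b n∣o) (m<n⇒m%n≡m b<n))

  offset-lift : ∀ {a b} → a ≤ b → b < a + n → offset (a mod n) (b mod n) ≡ b ∸ a
  offset-lift {a} {b} a≤b b<a+n =
    subst (λ v → offset (a mod n) (v mod n) ≡ b ∸ a) (m+[n∸m]≡n a≤b) (offset-mod a b∸a<n)
    where
    b∸a<n = +-cancelˡ-< a (b ∸ a) n (subst (_< a + n) (sym (m+[n∸m]≡n a≤b)) b<a+n)

  hop⇒arc : ∀ {a b} → a < b → b ≤ a + k → b < a + n → D (a mod n) (b mod n)
  hop⇒arc {a} {b} a<b b≤a+k b<a+n = subst (λ s → 1 ≤ s × s ≤ k) (sym (offset-lift (<⇒≤ a<b) b<a+n))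
    (m<n⇒0<n∸m a<b , ≤-trans (∸-monoˡ-≤ a b≤a+k) (≤-reflexive (m+n∸m≡n a k)))

  mod-≢ : ∀ {a b} → a < b → b < a + n → a mod n ≢ b mod n
  mod-≢ a<b b<a+n = offset≢0⇒≢ λ eq →
    <⇒≢ (m<n⇒0<n∸m a<b) (sym (trans (sym (offset-lift (<⇒≤ a<b) b<a+n)) eq))

  ascent⇒walk : ∀ {a us e} → Ascent k a us e → e < a + n → Walk D (a mod n) (map (_mod n) us) (e mod n)
  ascent⇒walk []                e<a+n = stop
  ascent⇒walk (hop a<b b≤ asc) e<a+n = step (hop⇒arc a<b b≤ (≤-<-trans (ascent-≤ asc) e<a+n))
    (ascent⇒walk asc (<-≤-trans e<a+n (+-monoˡ-≤ n (<⇒≤ a<b))))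

  ascent⇒unique : ∀ {a us e} → Ascent k a us e → e < a + n → Unique (a mod n ∷ map (_mod n) us)
  ascent⇒unique []                    e<a+n = [] ∷ []
  ascent⇒unique asc@(hop a<b _ asc′) e<a+n =
    All-map⁺ (All.map (λ (a<c , c≤e) → mod-≢ a<c (≤-<-trans c≤e e<a+n)) (ascent-bounds asc))
    ∷ ascent⇒unique asc′ (<-≤-trans e<a+n (+-monoˡ-≤ n (<⇒≤ a<b)))

  RainbowGeodesic : Fin n → Fin n → Set
  RainbowGeodesic x y = Σ (Path D x y) λ p → Rainbow colour p × IsDistance D x y (len p)

  ascent⇒rainbow-geodesic : ∀ {x y us e} d → Ascent k (toℕ x) us e → toℕ x + d ≡ e → e % n ≡ toℕ y →
    d < n → length us * k < d + k → Unique (map block us) → RainbowGeodesic x y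
  ascent⇒rainbow-geodesic {x} {y} {us} {e} d asc x+d≡e e%n≡y d<n short blocks-unique =
    p , rainbowP , len*k<offset+k⇒IsDistance p
      (subst₂ (λ L o → L * k < o + k) (sym (length-map (_mod n) us)) (sym offset≡d) short)
    where
    e<x+n : e < toℕ x + n
    e<x+n = subst (_< toℕ x + n) x+d≡e (+-monoʳ-< (toℕ x) d<n)
    p : Path D x y
    p = mkPath (map (_mod n) us)
      (subst₂ (λ u v → Walk D u (map (_mod n) us) v) (toℕ-mod x) (mod-toℕ e%n≡y) (ascent⇒walk asc e<x+n))
      (subst (λ u → Unique (u ∷ map (_mod n) us)) (toℕ-mod x) (ascent⇒unique asc e<x+n))
    rainbowP : Rainbow colour p
    rainbowP = Unique.map⁻ (subst Unique (sym (colours-lift x us)) blocks-unique)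
    offset≡d : offset x y ≡ d
    offset≡d = offset-unique d<n (trans (cong (_% n) x+d≡e) e%n≡y)

  -- With y - x = 1 + t + q k: one step of size 1 + t, then q steps of size k.
  geodesic-up : ∀ {x y} → toℕ x < toℕ y → RainbowGeodesic x y
  geodesic-up {x} {y} x<y = ascent⇒rainbow-geodesic (suc (t + q * k)) asc
    (sym (+-assoc X (suc t) (q * k))) (trans (cong (_% n) e≡Y) (m<n⇒m%n≡m (toℕ<n y)))
    (≤-<-trans (m≤n+m _ X) (subst (_< n) (sym X+d≡Y) (toℕ<n y)))
    (subst (λ L → L * k < suc (t + q * k) + k) (sym (length-iterate (_+ k) _ (suc q))) short)
    (subst Unique (sym (block-progression 0 (X + suc t) (suc q) (n ∣0) bound)) (iterate-suc-unique _ (suc q)))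
    where
    X = toℕ x
    r = toℕ y ∸ suc X
    t = r % k
    q = r / k
    X+d≡Y : X + suc (t + q * k) ≡ toℕ y
    X+d≡Y = trans (+-suc X (t + q * k)) (trans (cong (suc X +_) (sym (m≡m%n+[m/n]*n r k))) (m+[n∸m]≡n x<y))
    e≡Y : X + suc t + q * k ≡ toℕ y
    e≡Y = trans (+-assoc X (suc t) (q * k)) X+d≡Y
    asc : Ascent k X (iterate (_+ k) (X + suc t) (suc q)) (X + suc t + q * k)
    asc = hop (m<m+n X z<s) (+-monoʳ-≤ X (m%n<n r k)) (progression (X + suc t) q)
    short : k + q * k < suc (t + q * k) + k
    short = s≤s (subst (_≤ t + q * k + k) (+-comm (q * k) k) (+-monoˡ-≤ k (m≤n+m (q * k) t)))
    bound : X + suc t + suc q * k < n + k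
    bound = subst (_< n + k) (sym (trans (cong (X + suc t +_) (+-comm k (q * k))) (sym (+-assoc _ (q * k) k))))
      (+-monoˡ-< k (subst (_< n) (sym e≡Y) (toℕ<n y)))

  -- For y < x: climb in the top blocks, cross 0, then climb from y % k to y in the bottom blocks.
  -- With n = 1 + x + s + p k and y = t + q k, the crossing jump has size 1 + s + t if that is at most
  -- k; otherwise the first step has size s and the path passes through n - 1.
  module Wrap {x y : Fin n} (y<x : toℕ y < toℕ x) where
    X = toℕ x
    Y = toℕ y
    r = n ∸ suc X
    s = r % k
    p = r / k
    t = Y % k
    q = Y / k
    top = X + s + p * k
    d = suc (s + p * k) + Y
    e = n + t + q * k
    lower = iterate (_+ k) (n + t) (suc q)

    suc[top]≡n : suc top ≡ n
    suc[top]≡n = trans (cong suc (+-assoc X s (p * k)))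
      (trans (cong (suc X +_) (sym (m≡m%n+[m/n]*n r k))) (m+[n∸m]≡n (toℕ<n x)))

    top<n : top < n
    top<n = subst (top <_) suc[top]≡n (n<1+n top)

    t+q*k≡Y : t + q * k ≡ Y
    t+q*k≡Y = sym (m≡m%n+[m/n]*n Y k)

    X+d≡e : X + d ≡ e
    X+d≡e = begin
      X + (suc (s + p * k) + Y)   ≡⟨ x+[1+s+p+y]≡1+x+s+p+y X s (p * k) Y ⟩
      suc top + Y                 ≡⟨ cong₂ _+_ suc[top]≡n (sym t+q*k≡Y) ⟩
      n + (t + q * k)             ≡⟨ +-assoc n t (q * k) ⟨
      e                           ∎
      where
      open ≡-Reasoning
      x+[1+s+p+y]≡1+x+s+p+y : ∀ x s p y → x + (suc (s + p) + y) ≡ suc (x + s + p) + y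
      x+[1+s+p+y]≡1+x+s+p+y = solve-∀

    e%n≡Y : e % n ≡ Y
    e%n≡Y = begin
      (n + t + q * k) % n ≡⟨ cong (_% n) (trans (+-assoc n t (q * k)) (cong (n +_) t+q*k≡Y)) ⟩
      (n + Y) % n         ≡⟨ %-remove-+ˡ Y ∣-refl ⟩
      Y % n               ≡⟨ m<n⇒m%n≡m (toℕ<n y) ⟩
      Y                   ∎
      where open ≡-Reasoning

    d<n : d < n
    d<n = subst (d <_) (trans ([1+s+p]+x≡1+x+s+p s (p * k) X) suc[top]≡n) (+-monoʳ-< (suc (s + p * k)) y<x)
      where
      [1+s+p]+x≡1+x+s+p : ∀ s p x → suc (s + p) + x ≡ suc (x + s + p)
      [1+s+p]+x≡1+x+s+p = solve-∀

    lower-ascent : Ascent k (n + t) (iterate (_+ k) (n + t + k) q) e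
    lower-ascent = progression (n + t) q

    lower-blocks : map block lower ≡ iterate suc 0 (suc q)
    lower-blocks = trans (block-progression n t (suc q) ∣-refl bound)
      (cong (λ v → iterate suc v (suc q)) (m<n⇒m/n≡0 (m%n<n Y k)))
      where
      bound : t + suc q * k < n + k
      bound = subst (_< n + k)
        (trans (cong (_+ k) (sym t+q*k≡Y)) (trans (+-assoc t (q * k) k) (cong (t +_) (+-comm (q * k) k))))
        (+-monoˡ-< k (toℕ<n y))

    -- The length hypothesis bounds the number of steps by ⌈d / k⌉, since d + k = 1 + s + t + (p + 1 + q) k.
    wrap : ∀ a m → Ascent k X (iterate (_+ k) a m ++ lower) e → (m + suc q) * k ≤ s + t + (p + suc q) * k →
      a + m * k < n + k → suc q ≤ a / k → RainbowGeodesic x y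
    wrap a m asc length≤ bound q<a/k = ascent⇒rainbow-geodesic d asc X+d≡e e%n≡Y d<n
      (subst₂ (λ L o → L * k < o) (sym length≡) (sym d+k≡) (s≤s length≤))
      (subst Unique (sym blocks≡) (iterate-suc-++-unique (a / k) m 0 (suc q) q<a/k))
      where
      length≡ : length (iterate (_+ k) a m ++ lower) ≡ m + suc q
      length≡ = trans (length-++ (iterate (_+ k) a m))
        (cong₂ _+_ (length-iterate _ a m) (length-iterate _ (n + t) (suc q)))
      d+k≡ : d + k ≡ suc (s + t + (p + suc q) * k)
      d+k≡ = trans (cong (λ v → suc (s + p * k) + v + k) (sym t+q*k≡Y)) (identity s t p q k)
        where
        identity : ∀ s t p q k → suc (s + p * k) + (t + q * k) + k ≡ suc (s + t + (p + suc q) * k)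
        identity = solve-∀
      blocks≡ : map block (iterate (_+ k) a m ++ lower) ≡ iterate suc (a / k) m ++ iterate suc 0 (suc q)
      blocks≡ = trans (map-++ block (iterate (_+ k) a m) lower)
        (cong₂ _++_ (block-progression 0 a m (n ∣0) bound) lower-blocks)

    geodesic-wrap-jump : suc (s + t) ≤ k → RainbowGeodesic x y
    geodesic-wrap-jump s+t<k = wrap (X + k) p
      (ascent-++ (progression X p) (hop X+p*k<n+t n+t≤ lower-ascent))
      (m≤n+m _ (s + t))
      (subst (_< n + k) X+p*k+k≡X+k+p*k (+-monoˡ-< k X+p*k<n))
      (subst (suc q ≤_) (sym ([m+n]/n≡1+m/n X k)) (s≤s (/-monoˡ-≤ k (<⇒≤ y<x))))
      where
      X+p*k<n : X + p * k < n
      X+p*k<n = ≤-<-trans (+-monoˡ-≤ (p * k) (m≤m+n X s)) top<n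
      X+p*k<n+t : X + p * k < n + t
      X+p*k<n+t = <-≤-trans X+p*k<n (m≤m+n n t)
      X+p*k+k≡X+k+p*k : X + p * k + k ≡ X + k + p * k
      X+p*k+k≡X+k+p*k = trans (+-assoc X (p * k) k) (trans (cong (X +_) (+-comm (p * k) k)) (sym (+-assoc X k (p * k))))
      n+t≤ : n + t ≤ X + p * k + k
      n+t≤ = subst (λ v → v + t ≤ X + p * k + k) suc[top]≡n
        (subst (_≤ X + p * k + k) (sym ([1+x+s+p]+t≡x+p+[1+s+t] X s (p * k) t)) (+-monoʳ-≤ (X + p * k) s+t<k))
        where
        [1+x+s+p]+t≡x+p+[1+s+t] : ∀ x s p t → suc (x + s + p) + t ≡ x + p + suc (s + t)
        [1+x+s+p]+t≡x+p+[1+s+t] = solve-∀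

    geodesic-wrap-top : k ≤ s + t → RainbowGeodesic x y
    geodesic-wrap-top k≤s+t = wrap (X + s) (suc p)
      (ascent-++ (hop (m<m+n X 0<s) (+-monoʳ-≤ X (<⇒≤ (m%n<n r k))) (progression (X + s) p))
                 (hop (<-≤-trans top<n (m≤m+n n t)) n+t≤top+k lower-ascent))
      (+-monoˡ-≤ _ k≤s+t)
      (subst (_< n + k) (trans (+-assoc (X + s) (p * k) k) (cong (X + s +_) (+-comm (p * k) k))) (+-monoˡ-< k top<n))
      (subst (_≤ (X + s) / k) (m*n/n≡m (suc q) k) (/-monoˡ-≤ k [1+q]*k≤X+s))
      where
      0<s : 0 < s
      0<s = ≰⇒> λ s≤0 → <⇒≱ (m%n<n Y k) (≤-trans k≤s+t (+-monoˡ-≤ t s≤0))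
      n+t≤top+k : n + t ≤ top + k
      n+t≤top+k = subst (λ v → v + t ≤ top + k) suc[top]≡n
        (subst (_≤ top + k) (+-suc top t) (+-monoʳ-≤ top (m%n<n Y k)))
      [1+q]*k≤X+s : suc q * k ≤ X + s
      [1+q]*k≤X+s = begin
        k + q * k       ≤⟨ +-monoˡ-≤ (q * k) k≤s+t ⟩
        s + t + q * k   ≡⟨ trans (+-assoc s t (q * k)) (cong (s +_) t+q*k≡Y) ⟩
        s + Y           ≤⟨ +-monoʳ-≤ s (<⇒≤ y<x) ⟩
        s + X           ≡⟨ +-comm s X ⟩
        X + s           ∎
        where open ≤-Reasoning

    geodesic-wrap : RainbowGeodesic x y
    geodesic-wrap with suc (s + t) ≤? k
    ... | yes s+t<k = geodesic-wrap-jump s+t<k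
    ... | no  s+t≮k = geodesic-wrap-top (≤-pred (≰⇒> s+t≮k))

  strong-rainbow : StrongRainbowConnecting D (ceilDiv n k)
  strong-rainbow = colour , rainbow-geodesic
    where
    rainbow-geodesic : ∀ x y → x ≢ y → RainbowGeodesic x y
    rainbow-geodesic x y x≢y with <-cmp (toℕ x) (toℕ y)
    ... | tri< x<y _ _ = geodesic-up x<y
    ... | tri≈ _ x≡y _ = contradiction (toℕ-injective x≡y) x≢y
    ... | tri> _ _ y<x = Wrap.geodesic-wrap y<x

theorem6 : (n k : ℕ) → .{{_ : NonZero n}} → .{{_ : NonZero k}} → 1 ≤ k → k ≤ n ∸ 2 →
    rc*≡ (circulant n k) (ceilDiv n k) × src*≡ (circulant n k) (ceilDiv n k)
theorem6 n k 1≤k k≤n∸2 =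
    (strong⇒rainbow strong-rainbow , rainbow-lower k+2≤n)
  , (strong-rainbow , λ c → rainbow-lower k+2≤n c ∘ strong⇒rainbow)
  where
  open Circulant n k
  k+2≤n : k + 2 ≤ n
  k+2≤n = m≤o∸n⇒m+n≤o k (<⇒≤ (m∸n≢0⇒n<m (≢-sym (<⇒≢ (≤-trans 1≤k k≤n∸2))))) k≤n∸2
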